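{- Let $\Sigma$ be a totally ordered alphabet with $\sigma$ letters, let $p\geq 1$, and let $A$ be a finite multiset of strings over $\Sigma$ all of length $p$. Then $\rho(A)\leq\sigma^p$.
   Context: For a string $x=x_1\cdots x_n$, $\texttt{runs}(x)=\sum_{i=1}^{n-1}\mathbf{1}_{x_i\neq x_{i+1}}$. Every string $u$ can be written uniquely as $u=v^e$ with $v$ primitive; write $\mathrm{root}(u)=v$, $\exp(u)=e$. The $\omega$-order: $u\preceq_\omega v$ iff either $\mathrm{root}(u)=\mathrm{root}(v)$ and $\exp(u)\leq\exp(v)$, or $\mathrm{root}(u)\neq\mathrm{root}(v)$ and $u^\omega<_{\mathrm{lex}}v^\omega$. For a multiset $W$ of nonempty strings, $\texttt{ebwt}(W)$ is obtained by listing all circular rotations of all strings of $W$ (one per position of each string, with multiplicity), sorting them in ascending $\omega$-order, and concatenating their last characters. $\rho(W)=\texttt{runs}(\texttt{ebwt}(W))$. -}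

module Defs where

open import Data.Nat using (ℕ; zero; suc; _+_; _≤_; _<_; _%_)
open import Data.Nat.DivMod using (m%n<n)
open import Data.Fin as Fin using (Fin; fromℕ<)
open import Data.List using (List; []; _∷_; length; drop; take; _++_; map; concatMap; replicate; concat; upTo; last; mapMaybe; lookup)
open import Data.List.Relation.Unary.Linked using (Linked)
open import Data.List.Relation.Binary.Permutation.Propositional using (_↭_)
open import Data.Maybe using (Maybe; just; nothing)
open import Data.Product using (Σ; ∃; ∃-syntax; _×_; _,_)
open import Data.Sum using (_⊎_)
open import Relation.Nullary using (yes; no)
open import Relation.Binary.PropositionalEquality using (_≡_; _≢_)

Str : ℕ → Set
Str σ = List (Fin σ)

-- runs(x) = number of i with x_i ≠ x_{i+1}
runsFrom : ∀ {σ} → Fin σ → Str σ → ℕ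
runsFrom x [] = 0
runsFrom x (y ∷ xs) with x Fin.≟ y
... | yes _ = runsFrom y xs
... | no _ = suc (runsFrom y xs)

runs : ∀ {σ} → Str σ → ℕ
runs [] = 0
runs (x ∷ xs) = runsFrom x xs

pow : ∀ {σ} → Str σ → ℕ → Str σ
pow u k = concat (replicate k u)

Primitive : ∀ {σ} → Str σ → Set
Primitive u = 1 ≤ length u × (∀ v k → 2 ≤ k → pow v k ≢ u)

RootExp : ∀ {σ} → Str σ → Str σ → ℕ → Set
RootExp u v e = Primitive v × 1 ≤ e × pow v e ≡ u

-- the n-th character of the infinite string u^ω (nothing iff u is empty)
ωAt : ∀ {σ} → Str σ → ℕ → Maybe (Fin σ)
ωAt [] n = nothing
ωAt (x ∷ xs) n = just (lookup (x ∷ xs) (fromℕ< (m%n<n n (suc (length xs)))))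

_<ω-lex_ : ∀ {σ} → Str σ → Str σ → Set
_<ω-lex_ {σ} u v = ∃[ k ] ((∀ i → i < k → ωAt u i ≡ ωAt v i) ×
                    Σ (Fin σ) λ a → Σ (Fin σ) λ b →
                      ωAt u k ≡ just a × ωAt v k ≡ just b × a Fin.< b)

_⪯ω_ : ∀ {σ} → Str σ → Str σ → Set
u ⪯ω w = Σ _ λ v → Σ ℕ λ e → Σ _ λ v' → Σ ℕ λ e' →
  RootExp u v e × RootExp w v' e' ×
  ((v ≡ v' × e ≤ e') ⊎ (v ≢ v' × u <ω-lex w))

rotations : ∀ {σ} → Str σ → List (Str σ)
rotations u = map (λ i → drop i u ++ take i u) (upTo (length u))

allRotations : ∀ {σ} → List (Str σ) → List (Str σ)
allRotations W = concatMap rotations W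

-- b = ebwt(W): b is the sequence of last characters of some listing of all
-- rotations of W sorted in ascending ω-order (such a listing exists and b does
-- not depend on its choice, since ⪯ω-equivalent rotations are equal).
IsEBWT : ∀ {σ} → List (Str σ) → Str σ → Set
IsEBWT W b = Σ _ λ L → L ↭ allRotations W × Linked _⪯ω_ L × b ≡ mapMaybe last L

{-# OPTIONS --safe #-}
module Submission where

-- Read a string of length p as a base-σ numeral, so that its value is below σ^p.  For strings
-- of equal length the ω-order refines the order of values: equal roots force equal exponents,
-- hence equal strings, and a first difference of u^ω and w^ω at k yields one of u and w at
-- k mod p.  Along the ω-sorted list of rotations the value therefore never decreases and
-- increases strictly whenever the rotation changes.  A run boundary of the ebwt needs a change
-- of rotation, so there are fewer boundaries than the σ^p possible values.

open import Defs
open import Level using (Level)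
open import Data.Nat using (ℕ; zero; suc; _≤_; _<_; _^_; _+_; _*_; _%_; z≤n; s≤s; z<s; NonZero; >-nonZero)
open import Data.Nat.Properties
open import Data.Nat.DivMod using (m%n<n; m%n≤m; m<n⇒m%n≡m)
open import Data.Fin as Fin using (Fin; toℕ; fromℕ<)
open import Data.Fin.Properties using (toℕ<n)
open import Data.List using (List; []; _∷_; length; drop; take; _++_; last; mapMaybe; lookup)
open import Data.List.Properties using (length-++; take++drop≡id)
open import Data.List.Relation.Unary.All as All using (All; []; _∷_; universal)
open import Data.List.Relation.Unary.All.Properties using (++⁺; map⁺)
open import Data.List.Relation.Unary.AllPairs using (AllPairs; []; _∷_)
open import Data.List.Relation.Unary.Linked using (Linked; []; [-]; _∷_)
open import Data.List.Relation.Unary.Linked.Properties using (Linked⇒AllPairs)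
open import Data.List.Relation.Binary.Permutation.Propositional using (↭-sym)
open import Data.List.Relation.Binary.Permutation.Propositional.Properties using (All-resp-↭)
open import Data.Maybe using (Maybe; just; nothing)
open import Data.Maybe.Properties using (just-injective)
open import Data.Product using (_,_)
open import Data.Sum using (_⊎_; inj₁; inj₂)
open import Relation.Binary.Definitions using (Transitive)
open import Relation.Nullary using (yes; no; contradiction)
open import Relation.Binary.PropositionalEquality

private
  variable
    a : Level
    A : Set a
    σ : ℕ

lookupMaybe : List A → ℕ → Maybe A
lookupMaybe [] _ = nothing
lookupMaybe (x ∷ xs) zero = just x
lookupMaybe (_ ∷ xs) (suc i) = lookupMaybe xs i

lookupMaybe-fromℕ< : (xs : List A) {i : ℕ} (i<n : i < length xs) →
  lookupMaybe xs i ≡ just (lookup xs (fromℕ< i<n))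
lookupMaybe-fromℕ< (_ ∷ _) {zero} _ = refl
lookupMaybe-fromℕ< (_ ∷ xs) {suc i} (s≤s i<n) = lookupMaybe-fromℕ< xs i<n

length-rotation : (u : List A) (i : ℕ) → length (drop i u ++ take i u) ≡ length u
length-rotation u i = begin
  length (drop i u ++ take i u)           ≡⟨ length-++ (drop i u) ⟩
  length (drop i u) + length (take i u)   ≡⟨ +-comm (length (drop i u)) _ ⟩
  length (take i u) + length (drop i u)   ≡⟨ sym (length-++ (take i u)) ⟩
  length (take i u ++ drop i u)           ≡⟨ cong length (take++drop≡id i u) ⟩
  length u                                ∎
  where open ≡-Reasoning

_⊑[_]_ : A → (A → ℕ) → A → Set _
u ⊑[ f ] w = u ≡ w ⊎ f u < f w

⊑-trans : (f : A → ℕ) → Transitive (_⊑[ f ]_)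
⊑-trans _ (inj₁ refl) w⊑x = w⊑x
⊑-trans _ (inj₂ fu<fw) (inj₁ refl) = inj₂ fu<fw
⊑-trans _ (inj₂ fu<fw) (inj₂ fw<fx) = inj₂ (<-trans fu<fw fw<fx)

runsFrom-∷-≤ : (c d : Fin σ) (xs : Str σ) → runsFrom c (d ∷ xs) ≤ suc (runsFrom d xs)
runsFrom-∷-≤ c d xs with c Fin.≟ d
... | yes _ = n≤1+n _
... | no _ = ≤-refl

runsFrom-∷-self : (c : Fin σ) (xs : Str σ) → runsFrom c (c ∷ xs) ≡ runsFrom c xs
runsFrom-∷-self c xs with c Fin.≟ c
... | yes _ = refl
... | no c≢c = contradiction refl c≢c

module _ (f : A → ℕ) (g : A → Maybe (Fin σ)) {N : ℕ} where

  -- Each run boundary is paid for by a strict increase of f, and f stays below N.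
  runsFrom-mapMaybe-< : ∀ {u c L} → g u ≡ just c → AllPairs _⊑[ f ]_ (u ∷ L) →
    All (λ w → f w < N) (u ∷ L) → runsFrom c (mapMaybe g L) + f u < N
  runsFrom-mapMaybe-< {L = []} _ _ (fu<N ∷ []) = fu<N
  runsFrom-mapMaybe-< {u} {c} {w ∷ L} gu≡c ((u⊑w ∷ u⊑L) ∷ w⊑L ∷ ordered) (fu<N ∷ fw<N ∷ bounded)
    with g w in gw≡d | u⊑w
  ... | nothing | _ = runsFrom-mapMaybe-< gu≡c (u⊑L ∷ ordered) (fu<N ∷ bounded)
  ... | just d | inj₁ refl with just-injective (trans (sym gu≡c) gw≡d)
  ...   | refl = subst (λ r → r + f u < N) (sym (runsFrom-∷-self c (mapMaybe g L)))
                   (runsFrom-mapMaybe-< gw≡d (w⊑L ∷ ordered) (fw<N ∷ bounded))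
  runsFrom-mapMaybe-< {u} {c} {w ∷ L} _ ((_ ∷ _) ∷ w⊑L ∷ ordered) (_ ∷ fw<N ∷ bounded)
      | just d | inj₂ fu<fw = begin-strict
    runsFrom c (d ∷ X) + f u    ≤⟨ +-monoˡ-≤ (f u) (runsFrom-∷-≤ c d X) ⟩
    suc (runsFrom d X) + f u    ≡⟨ sym (+-suc (runsFrom d X) (f u)) ⟩
    runsFrom d X + suc (f u)    ≤⟨ +-monoʳ-≤ (runsFrom d X) fu<fw ⟩
    runsFrom d X + f w          <⟨ runsFrom-mapMaybe-< gw≡d (w⊑L ∷ ordered) (fw<N ∷ bounded) ⟩
    N                           ∎
    where
      open ≤-Reasoning
      X = mapMaybe g L

  runs-mapMaybe-≤ : ∀ {L} → AllPairs _⊑[ f ]_ L → All (λ w → f w < N) L → runs (mapMaybe g L) ≤ N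
  runs-mapMaybe-≤ {[]} _ _ = z≤n
  runs-mapMaybe-≤ {u ∷ L} ordered bounded with g u in gu≡c
  ... | just c = ≤-trans (m≤m+n _ (f u)) (<⇒≤ (runsFrom-mapMaybe-< gu≡c ordered bounded))
  runs-mapMaybe-≤ {u ∷ L} (_ ∷ ordered) (_ ∷ bounded) | nothing = runs-mapMaybe-≤ ordered bounded

value : Str σ → ℕ
value [] = 0
value {σ} (x ∷ xs) = toℕ x * σ ^ length xs + value xs

value<σ^length : (u : Str σ) → value u < σ ^ length u

value-∷-< : (x : Fin σ) (xs : Str σ) → value (x ∷ xs) < suc (toℕ x) * σ ^ length xs
value-∷-< {σ} x xs = begin-strict
  toℕ x * σ ^ length xs + value xs       <⟨ +-monoʳ-< (toℕ x * σ ^ length xs) (value<σ^length xs) ⟩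
  toℕ x * σ ^ length xs + σ ^ length xs  ≡⟨ +-comm (toℕ x * σ ^ length xs) _ ⟩
  suc (toℕ x) * σ ^ length xs            ∎
  where open ≤-Reasoning

value<σ^length [] = z<s
value<σ^length {σ} (x ∷ xs) = <-≤-trans (value-∷-< x xs) (*-monoˡ-≤ (σ ^ length xs) (toℕ<n x))

value-∷-mono-< : {a b : Fin σ} {u w : Str σ} → a Fin.< b → length u ≡ length w →
  value (a ∷ u) < value (b ∷ w)
value-∷-mono-< {σ} {a} {b} {u} {w} a<b |u|≡|w| = begin-strict
  value (a ∷ u)              <⟨ value-∷-< a u ⟩
  suc (toℕ a) * σ ^ length u ≤⟨ *-monoˡ-≤ (σ ^ length u) a<b ⟩
  toℕ b * σ ^ length u       ≡⟨ cong (λ n → toℕ b * σ ^ n) |u|≡|w| ⟩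
  toℕ b * σ ^ length w       ≤⟨ m≤m+n _ (value w) ⟩
  value (b ∷ w)              ∎
  where open ≤-Reasoning

value-mono-lex : ∀ {k} {a b : Fin σ} (u w : Str σ) → length u ≡ length w →
  (∀ i → i < k → lookupMaybe u i ≡ lookupMaybe w i) →
  lookupMaybe u k ≡ just a → lookupMaybe w k ≡ just b → a Fin.< b → value u < value w
value-mono-lex {k = zero} (_ ∷ u) (_ ∷ w) |u|≡|w| _ refl refl a<b =
  value-∷-mono-< {u = u} {w} a<b (suc-injective |u|≡|w|)
value-mono-lex {σ} {suc k} (x ∷ u) (_ ∷ w) |xu|≡|yw| agree uₖ≡a wₖ≡b a<b
  with just-injective (agree 0 z<s)
... | refl = +-mono-≤-< (≤-reflexive (cong (λ n → toℕ x * σ ^ n) |u|≡|w|))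
               (value-mono-lex u w |u|≡|w| (λ i i<k → agree (suc i) (s≤s i<k)) uₖ≡a wₖ≡b a<b)
  where |u|≡|w| = suc-injective |xu|≡|yw|

ωAt-% : (u : Str σ) {n : ℕ} .{{_ : NonZero n}} → length u ≡ n →
  ∀ i → ωAt u i ≡ lookupMaybe u (i % n)
ωAt-% (x ∷ xs) refl i = sym (lookupMaybe-fromℕ< (x ∷ xs) (m%n<n i (suc (length xs))))

ωAt-< : (u : Str σ) {i : ℕ} → i < length u → ωAt u i ≡ lookupMaybe u i
ωAt-< (x ∷ xs) {i} i<n = trans (ωAt-% (x ∷ xs) refl i) (cong (lookupMaybe (x ∷ xs)) (m<n⇒m%n≡m i<n))

<ω-lex⇒value< : (u w : Str σ) → length u ≡ length w → u <ω-lex w → value u < value w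
<ω-lex⇒value< [] _ _ (_ , _ , _ , _ , () , _)
<ω-lex⇒value< (_ ∷ _) [] _ (_ , _ , _ , _ , _ , () , _)
<ω-lex⇒value< u@(_ ∷ _) w@(_ ∷ _) |u|≡|w| (k , agree , a , b , uₖ≡a , wₖ≡b , a<b) =
  value-mono-lex u w |u|≡|w| agree-below-r
    (trans (sym (ωAt-% u refl k)) uₖ≡a) (trans (sym (ωAt-% w (sym |u|≡|w|) k)) wₖ≡b) a<b
  where
    -- Reduced modulo n, the first difference of u^ω and w^ω is a first difference of u and w.
    n = length u
    agree-below-r : ∀ i → i < k % n → lookupMaybe u i ≡ lookupMaybe w i
    agree-below-r i i<r = begin
      lookupMaybe u i  ≡⟨ sym (ωAt-< u i<n) ⟩
      ωAt u i          ≡⟨ agree i (<-≤-trans i<r (m%n≤m k n)) ⟩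
      ωAt w i          ≡⟨ ωAt-< w (subst (i <_) |u|≡|w| i<n) ⟩
      lookupMaybe w i  ∎
      where
        open ≡-Reasoning
        i<n = <-trans i<r (m%n<n k n)

length-pow : (v : Str σ) (e : ℕ) → length (pow v e) ≡ e * length v
length-pow v zero = refl
length-pow v (suc e) = trans (length-++ v) (cong (length v +_) (length-pow v e))

length-pow-injective : (v : Str σ) {e e′ : ℕ} → 1 ≤ length v →
  length (pow v e) ≡ length (pow v e′) → e ≡ e′
length-pow-injective v {e} {e′} 1≤|v| eq = *-cancelʳ-≡ e e′ (length v) {{>-nonZero 1≤|v|}}
  (trans (sym (length-pow v e)) (trans eq (length-pow v e′)))

⪯ω⇒⊑value : (u w : Str σ) → length u ≡ length w → u ⪯ω w → u ⊑[ value ] w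
⪯ω⇒⊑value _ _ |u|≡|w| (v , e , _ , e′ , ((1≤|v| , _) , _ , refl) , (_ , _ , refl) , inj₁ (refl , _)) =
  inj₁ (cong (pow v) (length-pow-injective v {e} {e′} 1≤|v| |u|≡|w|))
⪯ω⇒⊑value u w |u|≡|w| (_ , _ , _ , _ , _ , _ , inj₂ (_ , u<w)) = inj₂ (<ω-lex⇒value< u w |u|≡|w| u<w)

Linked-⪯ω⇒⊑value : ∀ {p} {L : List (Str σ)} → All (λ u → length u ≡ p) L → Linked _⪯ω_ L →
  Linked _⊑[ value ]_ L
Linked-⪯ω⇒⊑value _ [] = []
Linked-⪯ω⇒⊑value _ [-] = [-]
Linked-⪯ω⇒⊑value {L = u ∷ w ∷ _} (|u|≡p ∷ |w|≡p ∷ lengths) (u⪯w ∷ linked) =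
  ⪯ω⇒⊑value u w (trans |u|≡p (sym |w|≡p)) u⪯w ∷ Linked-⪯ω⇒⊑value (|w|≡p ∷ lengths) linked

allRotations-length : ∀ {p} (W : List (Str σ)) → All (λ u → length u ≡ p) W →
  All (λ u → length u ≡ p) (allRotations W)
allRotations-length [] [] = []
allRotations-length (u ∷ W) (|u|≡p ∷ lengths) =
  ++⁺ (map⁺ (universal (λ i → trans (length-rotation u i) |u|≡p) _)) (allRotations-length W lengths)

corollary3 : (σ p : ℕ) → 1 ≤ p → (A : List (Str σ)) → All (λ u → length u ≡ p) A →
    (b : Str σ) → IsEBWT A b → runs b ≤ σ ^ p
corollary3 σ p _ A lengths b (L , L↭rotations , sorted , refl) =
  runs-mapMaybe-≤ value last
    (Linked⇒AllPairs (⊑-trans value) (Linked-⪯ω⇒⊑value lengthsL sorted))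
    (All.map (λ {u} |u|≡p → subst (λ n → value u < σ ^ n) |u|≡p (value<σ^length u)) lengthsL)
  where
    lengthsL : All (λ u → length u ≡ p) L
    lengthsL = All-resp-↭ (↭-sym L↭rotations) (allRotations-length A lengths)
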